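{- Let $k\ge2$, let $B=(1,b_2,\dots,b_k)$ be positive integers with $1<b_2<\cdots<b_k$, let $c=\max\{O_B(r)\mid 0\le r\le b_k-1\}$, and let $a,h,d$ be positive integers with $\gcd(a,d)=1$. For integers $0\le r\le a-1$ and $m\in\mathbb{N}$ put $N_{dr}(m):=O_B(ma+r)\cdot ha+(ma+r)d$ and $N_{dr}:=\min\{N_{dr}(m)\mid m\in\mathbb{N}\}$. If $a\ge (c-1)b_k$, then for every $0\le r\le a-1$ we have $N_{dr}=N_{dr}(0)$.
   Context: For $M\in\mathbb{N}$, $O_B(M):=\min\{\sum_{i=1}^k x_i \mid \sum_{i=1}^k b_ix_i=M,\ x_i\in\mathbb{N}\}$ with $b_1=1$. $\mathbb{N}$ denotes the nonnegative integers. (For $A=(a,ha+db_1,\dots,ha+db_k)$, $N_{dr}$ equals the least element of the numerical semigroup generated by $A$ congruent to $dr$ modulo $a$.) -}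

module Defs where

open import Data.Nat using (ℕ; zero; suc; _+_; _*_; _≤_; _<_)
open import Data.Fin using (Fin)
open import Data.Product using (Σ; _×_; ∃)
open import Relation.Binary.PropositionalEquality using (_≡_)

Σᶠ : ∀ {k} → (Fin k → ℕ) → ℕ
Σᶠ {zero}  f = 0
Σᶠ {suc k} f = f Fin.zero + Σᶠ {k} (λ i → f (Fin.suc i))

Rep : ∀ {k} → (Fin k → ℕ) → ℕ → (Fin k → ℕ) → Set
Rep B M x = Σᶠ (λ i → B i * x i) ≡ M

IsOB : ∀ {k} → (Fin k → ℕ) → ℕ → ℕ → Set
IsOB B M n =
  Σ _ (λ (x : Fin _ → ℕ) → Rep B M x × Σᶠ x ≡ n)
  × (∀ (x : Fin _ → ℕ) → Rep B M x → n ≤ Σᶠ x)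

StrictInc : ∀ {k} → (Fin k → ℕ) → Set
StrictInc {k} B = ∀ (i j : Fin k) → Data.Fin._<_ i j → B i < B j

module Submission where

open import Defs
open import Data.Nat using (ℕ; zero; suc; _+_; _*_; _∸_; _≤_; _<_; z≤n; s≤s; NonZero; >-nonZero; _/_; _%_)
open import Data.Nat.GCD using (gcd)
open import Data.Nat.Properties
open import Data.Nat.DivMod using (m≡m%n+[m/n]*n; m%n<n)
open import Data.Fin using (Fin; fromℕ)
open import Data.Fin.Properties using (toℕ-injective; ≤fromℕ)
open import Data.Vec.Functional using (updateAt)
open import Data.Product using (Σ; _×_; _,_)
open import Data.Sum using (inj₁; inj₂)
open import Relation.Binary.PropositionalEquality
  using (_≡_; refl; sym; trans; cong; cong₂; subst; module ≡-Reasoning)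

-- Idea: appending ⌊r/b⌋ copies of the largest generator b to an optimal representation of r mod b
-- gives O r ≤ ⌊r/b⌋ + O (r mod b), with O (r mod b) ≤ c (and = 0 when b ∣ r), while every
-- representation of M uses at least M/b parts. For M ≥ a + r and a ≥ (c − 1) b the latter bound
-- already exceeds the former, so O r ≤ O M and both summands of N_{dr}(m) are minimal at m = 0.

Σᶠ-cong : ∀ {n} {f g : Fin n → ℕ} → (∀ i → f i ≡ g i) → Σᶠ f ≡ Σᶠ g
Σᶠ-cong {zero}  f≗g = refl
Σᶠ-cong {suc n} f≗g = cong₂ _+_ (f≗g Fin.zero) (Σᶠ-cong (λ i → f≗g (Fin.suc i)))

Σᶠ-zero : ∀ n → Σᶠ {n} (λ _ → 0) ≡ 0
Σᶠ-zero zero    = refl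
Σᶠ-zero (suc n) = Σᶠ-zero n

Σᶠ-mono-≤ : ∀ {n} {f g : Fin n → ℕ} → (∀ i → f i ≤ g i) → Σᶠ f ≤ Σᶠ g
Σᶠ-mono-≤ {zero}  f≤g = z≤n
Σᶠ-mono-≤ {suc n} f≤g = +-mono-≤ (f≤g Fin.zero) (Σᶠ-mono-≤ (λ i → f≤g (Fin.suc i)))

Σᶠ-*-distribˡ : ∀ {n} m (f : Fin n → ℕ) → Σᶠ (λ i → m * f i) ≡ m * Σᶠ f
Σᶠ-*-distribˡ {zero}  m f = sym (*-zeroʳ m)
Σᶠ-*-distribˡ {suc n} m f = begin
  m * f Fin.zero + Σᶠ (λ i → m * f (Fin.suc i)) ≡⟨ cong (m * f Fin.zero +_) (Σᶠ-*-distribˡ m (λ i → f (Fin.suc i))) ⟩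
  m * f Fin.zero + m * Σᶠ (λ i → f (Fin.suc i)) ≡⟨ *-distribˡ-+ m (f Fin.zero) _ ⟨
  m * Σᶠ f                                      ∎
  where open ≡-Reasoning

Σᶠ-*-updateAt-+ : ∀ {n} (g y : Fin n → ℕ) (j : Fin n) q →
  Σᶠ (λ i → g i * updateAt y j (_+ q) i) ≡ Σᶠ (λ i → g i * y i) + g j * q
Σᶠ-*-updateAt-+ {suc n} g y Fin.zero q = begin
  g₀ * (y₀ + q) + S   ≡⟨ cong (_+ S) (*-distribˡ-+ g₀ y₀ q) ⟩
  g₀ * y₀ + g₀ * q + S ≡⟨ +-assoc (g₀ * y₀) _ S ⟩
  g₀ * y₀ + (g₀ * q + S) ≡⟨ cong (g₀ * y₀ +_) (+-comm (g₀ * q) S) ⟩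
  g₀ * y₀ + (S + g₀ * q) ≡⟨ +-assoc (g₀ * y₀) S _ ⟨
  g₀ * y₀ + S + g₀ * q ∎
  where
  open ≡-Reasoning
  g₀ = g Fin.zero
  y₀ = y Fin.zero
  S = Σᶠ (λ i → g (Fin.suc i) * y (Fin.suc i))
Σᶠ-*-updateAt-+ {suc n} g y (Fin.suc j) q =
  trans (cong (g Fin.zero * y Fin.zero +_)
                (Σᶠ-*-updateAt-+ (λ i → g (Fin.suc i)) (λ i → y (Fin.suc i)) j q))
        (sym (+-assoc (g Fin.zero * y Fin.zero) _ _))

Σᶠ-updateAt-+ : ∀ {n} (y : Fin n → ℕ) (j : Fin n) q → Σᶠ (updateAt y j (_+ q)) ≡ Σᶠ y + q
Σᶠ-updateAt-+ y j q = begin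
  Σᶠ x                       ≡⟨ Σᶠ-cong (λ i → *-identityˡ (x i)) ⟨
  Σᶠ (λ i → 1 * x i)         ≡⟨ Σᶠ-*-updateAt-+ (λ _ → 1) y j q ⟩
  Σᶠ (λ i → 1 * y i) + 1 * q ≡⟨ cong₂ _+_ (Σᶠ-cong (λ i → *-identityˡ (y i))) (*-identityˡ q) ⟩
  Σᶠ y + q                   ∎
  where
  open ≡-Reasoning
  x = updateAt y j (_+ q)

StrictInc⇒mono : ∀ {n} {B : Fin n → ℕ} → StrictInc B → ∀ {i j} → i Data.Fin.≤ j → B i ≤ B j
StrictInc⇒mono inc {i} {j} i≤j with m≤n⇒m<n∨m≡n i≤j
... | inj₁ i<j = <⇒≤ (inc i j i<j)
... | inj₂ i≡j = ≤-reflexive (cong _ (toℕ-injective i≡j))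

module _ {n} {B : Fin n → ℕ} where

  IsOB-zero : ∀ {o} → IsOB B 0 o → o ≡ 0
  IsOB-zero (_ , minimal) =
    n≤0⇒n≡0 (subst (_ ≤_) (Σᶠ-zero n)
                   (minimal (λ _ → 0) (trans (Σᶠ-cong (λ i → *-zeroʳ (B i))) (Σᶠ-zero n))))

  IsOB-+-* : ∀ {t q o p} (j : Fin n) → IsOB B t o → IsOB B (t + q * B j) p → p ≤ o + q
  IsOB-+-* {t} {q} {o} j ((y , y-rep , Σy≡o) , _) (_ , minimal) =
    subst (_ ≤_) Σx≡o+q (minimal x x-rep)
    where
    x = updateAt y j (_+ q)
    x-rep : Rep B (t + q * B j) x
    x-rep = trans (Σᶠ-*-updateAt-+ B y j q) (cong₂ _+_ y-rep (*-comm (B j) q))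
    Σx≡o+q : Σᶠ x ≡ o + q
    Σx≡o+q = trans (Σᶠ-updateAt-+ y j q) (cong (_+ q) Σy≡o)

  IsOB-lowerBound : ∀ {b M o} → (∀ i → B i ≤ b) → IsOB B M o → M ≤ o * b
  IsOB-lowerBound {b} {M} {o} B≤b ((x , x-rep , Σx≡o) , _) = begin
    M                         ≡⟨ x-rep ⟨
    Σᶠ (λ i → B i * x i)      ≤⟨ Σᶠ-mono-≤ (λ i → *-monoˡ-≤ (x i) (B≤b i)) ⟩
    Σᶠ (λ i → b * x i)        ≡⟨ Σᶠ-*-distribˡ b x ⟩
    b * Σᶠ x                  ≡⟨ cong (b *_) Σx≡o ⟩
    b * o                     ≡⟨ *-comm b o ⟩
    o * b                     ∎
    where open ≤-Reasoning

  IsOB-mono-beyond : (O : ℕ → ℕ) → (∀ M → IsOB B M (O M)) →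
    ∀ {b c a} .{{_ : NonZero b}} (j : Fin n) → B j ≡ b → (∀ i → B i ≤ b) →
    (∀ t → t < b → O t ≤ c) → (c ∸ 1) * b ≤ a → ∀ {r M} → a + r ≤ M → O r ≤ O M
  IsOB-mono-beyond O isOB {b} {c} {a} j Bj≡b B≤b O≤c a≤ {r} {M} a+r≤M =
    ≤-trans (IsOB-+-* j (isOB t) (subst (λ N → IsOB B N (O r)) r≡t+q*Bj (isOB r)))
            (residue-bound t (m%n<n r b) (m≡m%n+[m/n]*n r b))
    where
    t = r % b
    q = r / b
    r≡t+q*Bj : r ≡ t + q * B j
    r≡t+q*Bj = trans (m≡m%n+[m/n]*n r b) (cong (λ z → t + q * z) (sym Bj≡b))
    r≤OM*b : r ≤ O M * b
    r≤OM*b = ≤-trans (m≤n+m r a) (≤-trans a+r≤M (IsOB-lowerBound B≤b (isOB M)))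
    residue-bound : ∀ s → s < b → r ≡ s + q * b → O s + q ≤ O M
    residue-bound zero    _   r≡q*b rewrite IsOB-zero (isOB 0) =
      *-cancelʳ-≤ q (O M) b (subst (_≤ O M * b) r≡q*b r≤OM*b)
    residue-bound (suc s) s<b r≡s+q*b = begin
      O (suc s) + q       ≤⟨ +-monoˡ-≤ q (≤-trans (O≤c (suc s) s<b) (m≤n+m∸n c 1)) ⟩
      suc (c ∸ 1 + q)     ≤⟨ *-cancelʳ-< b (c ∸ 1 + q) (O M) q+c∸1<OM ⟩
      O M                 ∎
      where
      open ≤-Reasoning
      q+c∸1<OM : (c ∸ 1 + q) * b < O M * b
      q+c∸1<OM = begin-strict
        (c ∸ 1 + q) * b      ≡⟨ *-distribʳ-+ b (c ∸ 1) q ⟩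
        (c ∸ 1) * b + q * b  ≤⟨ +-monoˡ-≤ (q * b) a≤ ⟩
        a + q * b            <⟨ +-monoʳ-< a (subst (q * b <_) (sym r≡s+q*b) (m<n+m (q * b) (s≤s z≤n))) ⟩
        a + r                ≤⟨ a+r≤M ⟩
        M                    ≤⟨ IsOB-lowerBound B≤b (isOB M) ⟩
        O M * b              ∎

lemma3p1 : (k : ℕ) (B : Fin (suc (suc k)) → ℕ)
    → B Fin.zero ≡ 1
    → StrictInc B
    → (O : ℕ → ℕ) → (∀ M → IsOB B M (O M))
    → (c : ℕ)
    → (∀ r → r < B (fromℕ (suc k)) → O r ≤ c)
    → Σ ℕ (λ r → r < B (fromℕ (suc k)) × O r ≡ c)
    → (a h d : ℕ) → 0 < a → 0 < h → 0 < d → gcd a d ≡ 1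
    → (c ∸ 1) * B (fromℕ (suc k)) ≤ a
    → ∀ r → r < a → ∀ (m : ℕ)
    → O (0 * a + r) * h * a + (0 * a + r) * d ≤ O (m * a + r) * h * a + (m * a + r) * d
lemma3p1 k B B₀≡1 inc O isOB c O≤c _ a h d _ _ _ _ a≥ r _ zero = ≤-refl
lemma3p1 k B B₀≡1 inc O isOB c O≤c _ a h d _ _ _ _ a≥ r _ (suc m) =
  +-mono-≤ (*-monoˡ-≤ a (*-monoˡ-≤ h Or≤OM)) (*-monoˡ-≤ d (m≤n+m r (suc m * a)))
  where
  last = fromℕ (suc k)
  B≤Blast : ∀ i → B i ≤ B last
  B≤Blast i = StrictInc⇒mono inc (≤fromℕ i)
  instance
    Blast≢0 : NonZero (B last)
    Blast≢0 = >-nonZero (subst (_≤ B last) B₀≡1 (B≤Blast Fin.zero))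
  Or≤OM : O r ≤ O (suc m * a + r)
  Or≤OM = IsOB-mono-beyond O isOB last refl B≤Blast O≤c a≥ (+-monoˡ-≤ r (m≤m+n a (m * a)))
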